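{- Let $N = \{a,b,c,d,e,f,g,h\}$ be a set of eight distinct elements and let $G = \{\{a,b\}, \{a,d,c\}, \{a,g,f\}, \{b,e,c\}, \{b,h,f\}\}$. In the game in which Black and White alternately claim previously unclaimed elements of $N$, Black moving first, until all of $N$ is claimed, White has a strategy guaranteeing that every set in $G$ contains at least one element claimed by White.
   Context: This is the "BiTriangle Configuration". The elements of $N$ are called markers, and the sets in $G$ are the traces on the markers of groups (possible winning lines) of a $k$-in-a-Row game. -}

module Defs where

open import Data.Nat using (ℕ)
open import Data.Nat as ℕ using ()
open import Data.Fin using (Fin; _≟_; zero; suc)
open import Data.List using (List; []; _∷_)
open import Data.List.Relation.Unary.All using (All)
open import Data.List.Relation.Unary.Any using (Any)
open import Data.Product using (Σ; _×_)
open import Relation.Binary.PropositionalEquality using (_≡_)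
open import Relation.Nullary using (yes; no)

data Owner : Set where
  free black white : Owner

Board : ℕ → Set
Board n = Fin n → Owner

emptyBoard : ∀ {n} → Board n
emptyBoard _ = free

claim : ∀ {n} → Board n → Fin n → Owner → Board n
claim B x p y with y ≟ x
... | yes _ = p
... | no  _ = B y

WhiteBlocksAll : ∀ {n} → List (List (Fin n)) → Board n → Set
WhiteBlocksAll G B = All (λ S → Any (λ x → B x ≡ white) S) G

-- The natural-number argument is the number of moves still to be played
-- (= number of free markers when started with n on the empty n-board);
-- when it reaches 0 the board is full and White's goal is evaluated.
mutual
  WhiteWinsBlackToMove : ∀ {n} → List (List (Fin n)) → ℕ → Board n → Set
  WhiteWinsBlackToMove G ℕ.zero    B = WhiteBlocksAll G B
  WhiteWinsBlackToMove G (ℕ.suc k) B =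
    (x : Fin _) → B x ≡ free → WhiteWinsWhiteToMove G k (claim B x black)

  WhiteWinsWhiteToMove : ∀ {n} → List (List (Fin n)) → ℕ → Board n → Set
  WhiteWinsWhiteToMove G ℕ.zero    B = WhiteBlocksAll G B
  WhiteWinsWhiteToMove {n} G (ℕ.suc k) B =
    Σ (Fin n) (λ x → B x ≡ free × WhiteWinsBlackToMove G k (claim B x white))

WhiteHasWinningStrategy : (n : ℕ) → List (List (Fin n)) → Set
WhiteHasWinningStrategy n G = WhiteWinsBlackToMove G n emptyBoard

mA mB mC mD mE mF mG mH : Fin 8
mA = zero
mB = suc zero
mC = suc (suc zero)
mD = suc (suc (suc zero))
mE = suc (suc (suc (suc zero)))
mF = suc (suc (suc (suc (suc zero))))
mG = suc (suc (suc (suc (suc (suc zero)))))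
mH = suc (suc (suc (suc (suc (suc (suc zero))))))

biTriangleGroups : List (List (Fin 8))
biTriangleGroups =
  (mA ∷ mB ∷ []) ∷
  (mA ∷ mD ∷ mC ∷ []) ∷
  (mA ∷ mG ∷ mF ∷ []) ∷
  (mB ∷ mE ∷ mC ∷ []) ∷
  (mB ∷ mH ∷ mF ∷ []) ∷ []

module Submission where

-- The configuration admits no pairing strategy (the pair {a,b} is forced,
-- after which {a,d,c} and {b,e,c} would both need a pair containing c), so
-- White's strategy has to react to Black's moves.  Rather than transcribing such a strategy, we
-- observe that the game-tree predicates of Defs are decidable for every
-- finite configuration: at a leaf White's goal is a finite conjunction of
-- finite disjunctions, Black's move is a universal quantifier over Fin n
-- and White's move an existential one, each guarded by the decidable test
-- "the marker is free".  Combining the standard decision procedures for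
-- these connectives gives a decision procedure for "White has a winning
-- strategy"; evaluating it on the BiTriangle configuration yields `yes`,
-- and the theorem is the witness extracted from that verdict.

open import Defs
open import Data.Nat using (ℕ; zero; suc)
open import Data.Fin using (Fin)
open import Data.Fin.Properties using (all?; any?)
open import Data.List using (List)
import Data.List.Relation.Unary.All as All
import Data.List.Relation.Unary.Any as Any
open import Relation.Binary.PropositionalEquality using (_≡_; refl)
open import Relation.Nullary using (Dec; yes; no)
open import Relation.Nullary.Decidable using (_×-dec_; _→-dec_; toWitness)

isFree? : (o : Owner) → Dec (o ≡ free)
isFree? free  = yes refl
isFree? black = no λ ()
isFree? white = no λ ()

isWhite? : (o : Owner) → Dec (o ≡ white)
isWhite? free  = no λ ()
isWhite? black = no λ ()
isWhite? white = yes refl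

whiteBlocksAll? : ∀ {n} (G : List (List (Fin n))) (B : Board n) →
                  Dec (WhiteBlocksAll G B)
whiteBlocksAll? G B = All.all? (Any.any? (λ x → isWhite? (B x))) G

mutual
  whiteWinsBlackToMove? : ∀ {n} (G : List (List (Fin n))) (k : ℕ) (B : Board n) →
                          Dec (WhiteWinsBlackToMove G k B)
  whiteWinsBlackToMove? G zero    B = whiteBlocksAll? G B
  whiteWinsBlackToMove? G (suc k) B =
    all? λ x → isFree? (B x) →-dec whiteWinsWhiteToMove? G k (claim B x black)

  whiteWinsWhiteToMove? : ∀ {n} (G : List (List (Fin n))) (k : ℕ) (B : Board n) →
                          Dec (WhiteWinsWhiteToMove G k B)
  whiteWinsWhiteToMove? G zero    B = whiteBlocksAll? G B
  whiteWinsWhiteToMove? G (suc k) B =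
    any? λ x → isFree? (B x) ×-dec whiteWinsBlackToMove? G k (claim B x white)

whiteHasWinningStrategy? : (n : ℕ) (G : List (List (Fin n))) →
                           Dec (WhiteHasWinningStrategy n G)
whiteHasWinningStrategy? n G = whiteWinsBlackToMove? G n emptyBoard

mainTheorem4 : WhiteHasWinningStrategy 8 biTriangleGroups
mainTheorem4 = toWitness {a? = whiteHasWinningStrategy? 8 biTriangleGroups} _
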